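{- Let $N$ be an odd perfect number, and write its prime factorization as $N=p_1^{a_1}p_2^{a_2}\cdots p_k^{a_k}$ with primes $p_1<p_2<\cdots<p_k$, where $k\ge 2$ and each $a_i\ge 1$. If $p_k < p_{k-1}+\sqrt{3p_{k-1}}-2$, then $$p_{k-1} < 2^{1/6}N^{1/6}.$$
   Context: A positive integer $N$ is perfect if $\sigma(N)=2N$, where $\sigma$ denotes the sum-of-divisors function; an odd perfect number is an odd positive integer with this property. -}

module Defs where

open import Data.Nat using (ℕ; zero; suc; _+_; _*_; _^_)
open import Data.Nat.Divisibility using (_∣?_)
open import Data.List using (List; filter)
open import Data.Nat.ListAction using (sum)
open import Data.List.Base using (upTo)
open import Data.Fin using (Fin)
import Data.Fin as F

-- divisors of n: all d with 1 ≤ d ≤ n and d ∣ n  (for n = 0 this is empty)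
divisors : ℕ → List ℕ
divisors n = filter (_∣? n) (Data.List.map suc (upTo n))

σ : ℕ → ℕ
σ n = sum (divisors n)

Perfect : ℕ → Set
Perfect N = σ N Relation.Binary.PropositionalEquality.≡ 2 * N
  where import Relation.Binary.PropositionalEquality

∏ : (k : ℕ) → (Fin k → ℕ) → ℕ
∏ zero    f = 1
∏ (suc k) f = f F.zero * ∏ k (λ i → f (F.suc i))

module Submission where

-- Let N = p₁^a₁ ⋯ p_k^a_k be odd and perfect, p₁ < ⋯ < p_k, and write q = p_{k-1},
-- r = p_k, x = a_{k-1}, y = a_k and N = M qˣ rʸ.  If (r - q + 2)² < 3q (the squared
-- form of p_k < p_{k-1} + √(3 p_{k-1}) - 2), then q⁶ < 2N, i.e. q < 2^{1/6} N^{1/6}.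
--
-- Proof.  σ is multiplicative, so σ(M) σ(qˣ) σ(rʸ) = 2N.  Both primes are odd, so
-- r = q + d with d even.  Closeness makes σ(q), σ(q²) small modulo r and σ(r), σ(r²)
-- small modulo q: a vanishing residue would be an odd number below three times the
-- modulus, hence equal to it, which forces q or r to be a perfect square.  So for
-- y ≤ 2 the factor qˣ of 2N is coprime to σ(qˣ) σ(rʸ) and must divide σ(M); likewise
-- rʸ ∣ σ(M) for x ≤ 2.  Counting exponents, q⁶ ≤ σ(M) qˣ rʸ in every case except
-- x = y = 1, which parity excludes (then 4 ∣ (q + 1)(r + 1) ∣ 2N); and finally
-- σ(M) qˣ rʸ < σ(M) σ(qˣ) σ(rʸ) = 2N.

open import Defs
open import Data.Nat using (ℕ; suc; _+_; _*_; _^_; _∸_; _<_; _≤_)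
open import Data.Nat.Primality using (Prime)
open import Data.Nat.DivMod using (_%_)
open import Data.Fin using (Fin; fromℕ; inject₁; toℕ)
open import Data.Fin.Properties using (toℕ-fromℕ; toℕ-inject₁; inject₁ℕ<)
import Data.Fin as F
open import Relation.Binary.PropositionalEquality using (_≡_)

open import Data.Nat
open import Data.Nat.Properties
open import Data.Nat.Divisibility
open import Data.Nat.Coprimality using (Coprime; coprime-divisor)
import Data.Nat.Coprimality as Coprimality
open import Data.Nat.GCD using (gcd; gcd[m,n]∣m; gcd[m,n]∣n; gcd-greatest; gcd[m,n]≢0)
open import Data.Nat.Primality
  using (prime⇒irreducible; prime⇒nonZero; prime⇒nonTrivial; euclidsLemma; composite-≢; composite⇒¬prime)
open import Data.Nat.ListAction using (sum)
open import Data.Nat.ListAction.Properties using (sum-++; sum-↭)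
open import Data.Nat.Tactic.RingSolver using (solve-∀)
open import Data.List using (List; []; _∷_; map; upTo; _++_; cartesianProductWith)
open import Data.List.Membership.Propositional using (_∈_)
open import Data.List.Membership.Propositional.Properties
  using (∈-filter⁺; ∈-filter⁻; ∈-map⁺; ∈-map⁻; ∈-upTo⁺;
         ∈-cartesianProductWith⁺; ∈-cartesianProductWith⁻)
open import Data.List.Membership.Propositional.Properties.WithK using (unique∧set⇒bag)
open import Data.List.Relation.Binary.BagAndSetEquality using (∼bag⇒↭)
open import Data.List.Relation.Unary.All as All using (All)
open import Data.List.Relation.Unary.Any using (here; there)
open import Data.List.Relation.Unary.Unique.Propositional using (Unique; []; _∷_)
import Data.List.Relation.Unary.Unique.Propositional.Properties as Unique
open import Data.Product using (∃; ∃₂; _×_; _,_; proj₂)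
open import Data.Sum using (inj₁; inj₂)
open import Data.Empty using (⊥-elim)
open import Function.Base using (_∘_)
open import Function.Bundles using (mk⇔)
open import Relation.Nullary using (¬_; yes; no)
open import Relation.Binary.PropositionalEquality
  using (_≢_; refl; sym; trans; cong; cong₂; subst; subst₂; module ≡-Reasoning)

∈-divisors⁻ : ∀ {n z} → z ∈ divisors n → z ∣ n
∈-divisors⁻ {n} z∈ = proj₂ (∈-filter⁻ (_∣? n) {xs = map suc (upTo n)} z∈)

∈-divisors⁺ : ∀ {n z} → .{{NonZero n}} → z ∣ n → z ∈ divisors n
∈-divisors⁺ {n} {zero}  0∣n with () ← ≢-nonZero⁻¹ n (0∣⇒≡0 0∣n)
∈-divisors⁺ {n} {suc z} z∣n = ∈-filter⁺ (_∣? n) (∈-map⁺ suc (∈-upTo⁺ (∣⇒≤ z∣n))) z∣n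

divisors-unique : ∀ n → Unique (divisors n)
divisors-unique n = Unique.filter⁺ (_∣? n) (Unique.map⁺ suc-injective (Unique.upTo⁺ n))

σ-enumeration : ∀ {n xs} → .{{NonZero n}} → Unique xs →
  (∀ {z} → z ∈ xs → z ∣ n) → (∀ {z} → z ∣ n → z ∈ xs) → σ n ≡ sum xs
σ-enumeration {n} xs! sound complete = sum-↭ (∼bag⇒↭ (unique∧set⇒bag (divisors-unique n) xs!
  (mk⇔ (λ z∈ → complete (∈-divisors⁻ z∈)) (λ z∈ → ∈-divisors⁺ (sound z∈)))))

prime>1 : ∀ {p} → Prime p → 1 < p
prime>1 {p} pp = nonTrivial⇒n>1 p {{prime⇒nonTrivial pp}}

prime∤1 : ∀ {p} → Prime p → ¬ p ∣ 1
prime∤1 pp p∣1 = <⇒≢ (prime>1 pp) (sym (∣1⇒≡1 p∣1))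

base-∣-power : ∀ {d} a → 1 ≤ a → d ∣ d ^ a
base-∣-power {d} (suc a) _ = m∣m*n (d ^ a)

prime∤⇒coprime : ∀ {p n} → Prime p → ¬ p ∣ n → Coprime n p
prime∤⇒coprime pp p∤n (d∣n , d∣p) with prime⇒irreducible pp d∣p
... | inj₁ d≡1 = d≡1
... | inj₂ refl = ⊥-elim (p∤n d∣n)

∣prime-power : ∀ {p d} → Prime p → ∀ a → d ∣ p ^ a → ∃ λ i → i ≤ a × d ≡ p ^ i
∣prime-power pp zero d∣1 = 0 , z≤n , ∣1⇒≡1 d∣1
∣prime-power {p} {d} pp (suc a) d∣pp^a with p ∣? d
... | no p∤d with i , i≤a , d≡ ← ∣prime-power pp a (coprime-divisor (prime∤⇒coprime pp p∤d) d∣pp^a) =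
  i , m≤n⇒m≤1+n i≤a , d≡
... | yes (divides k refl)
  with i , i≤a , refl ← ∣prime-power {d = k} pp a
         (*-cancelʳ-∣ p {{prime⇒nonZero pp}} (subst (k * p ∣_) (*-comm p (p ^ a)) d∣pp^a)) =
  suc i , s≤s i≤a , *-comm (p ^ i) p

prime∣power⇒prime∣ : ∀ {q m} → Prime q → ∀ n → q ∣ m ^ n → q ∣ m
prime∣power⇒prime∣ pq zero q∣1 with () ← prime∤1 pq q∣1
prime∣power⇒prime∣ {q} {m} pq (suc n) q∣ with euclidsLemma m (m ^ n) pq q∣
... | inj₁ q∣m  = q∣m
... | inj₂ q∣mⁿ = prime∣power⇒prime∣ pq n q∣mⁿ

prime∤product : ∀ {q a b} → Prime q → ¬ q ∣ a → ¬ q ∣ b → ¬ q ∣ a * b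
prime∤product {a = a} {b} pq q∤a q∤b q∣ab with euclidsLemma a b pq q∣ab
... | inj₁ q∣a = q∤a q∣a
... | inj₂ q∣b = q∤b q∣b

prime∤⇒coprime-power : ∀ {q n} → Prime q → ¬ q ∣ n → ∀ x → Coprime (q ^ x) n
prime∤⇒coprime-power {q} pq q∤n x (i∣qˣ , i∣n) with ∣prime-power pq x i∣qˣ
... | zero  , _ , i≡1    = i≡1
... | suc j , _ , refl   = ⊥-elim (q∤n (∣-trans (m∣m*n (q ^ j)) i∣n))

prime-power-∣-cancel : ∀ {q A B} → Prime q → ¬ q ∣ B → ∀ x → q ^ x ∣ B * A → q ^ x ∣ A
prime-power-∣-cancel pq q∤B x = coprime-divisor (prime∤⇒coprime-power pq q∤B x)

coprime-∣-product : ∀ {m n c} → Coprime m n → m ∣ c → n ∣ c → m * n ∣ c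
coprime-∣-product {m} {n} m⊥n (divides k refl) n∣km
  with divides j refl ← coprime-divisor (Coprimality.sym m⊥n) (subst (n ∣_) (*-comm k m) n∣km) =
  divides j (trans (*-assoc j n m) (cong (j *_) (*-comm n m)))

-- The divisors of pᵃ are exactly the powers pⁱ, i ≤ a, so σ(pᵃ) = pᵃ + ⋯ + p + 1.

powers : ℕ → ℕ → List ℕ
powers p zero    = 1 ∷ []
powers p (suc a) = p ^ suc a ∷ powers p a

∈-powers⁻ : ∀ {p} a {z} → z ∈ powers p a → ∃ λ i → i ≤ a × z ≡ p ^ i
∈-powers⁻ zero    (here refl) = 0 , z≤n , refl
∈-powers⁻ (suc a) (here refl) = suc a , ≤-refl , refl
∈-powers⁻ (suc a) (there z∈) with i , i≤a , refl ← ∈-powers⁻ a z∈ = i , m≤n⇒m≤1+n i≤a , refl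

∈-powers⁺ : ∀ {p} a {i} → i ≤ a → p ^ i ∈ powers p a
∈-powers⁺ zero    z≤n = here refl
∈-powers⁺ (suc a) i≤1+a with m≤n⇒m<n∨m≡n i≤1+a
... | inj₂ refl      = here refl
... | inj₁ (s≤s i≤a) = there (∈-powers⁺ a i≤a)

powers-unique : ∀ {p} → 1 < p → ∀ a → Unique (powers p a)
powers-unique 1<p zero    = All.[] ∷ []
powers-unique {p} 1<p (suc a) = All.tabulate top-is-new ∷ powers-unique 1<p a
  where
  top-is-new : ∀ {z} → z ∈ powers p a → p ^ suc a ≢ z
  top-is-new z∈ eq with i , i≤a , refl ← ∈-powers⁻ a z∈ =
    <⇒≢ (^-monoʳ-< p 1<p (s≤s i≤a)) (sym eq)

σ-prime-power : ∀ {p} → Prime p → ∀ a → σ (p ^ a) ≡ sum (powers p a)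
σ-prime-power {p} pp a = σ-enumeration (powers-unique (prime>1 pp) a) sound complete
  where
  instance
    p≢0 : NonZero p
    p≢0 = prime⇒nonZero pp
    pᵃ≢0 : NonZero (p ^ a)
    pᵃ≢0 = m^n≢0 p a
  sound : ∀ {z} → z ∈ powers p a → z ∣ p ^ a
  sound z∈ with i , i≤a , refl ← ∈-powers⁻ a z∈ =
    divides (p ^ (a ∸ i)) (trans (cong (p ^_) (sym (m∸n+n≡m i≤a))) (^-distribˡ-+-* p (a ∸ i) i))
  complete : ∀ {z} → z ∣ p ^ a → z ∈ powers p a
  complete z∣ with i , i≤a , refl ← ∣prime-power pp a z∣ = ∈-powers⁺ a i≤a

sum-powers≡1+p* : ∀ p a → ∃ λ t → sum (powers p a) ≡ 1 + p * t
sum-powers≡1+p* p zero = 0 , cong suc (sym (*-zeroʳ p))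
sum-powers≡1+p* p (suc a) with t , eq ← sum-powers≡1+p* p a =
  p ^ a + t , trans (cong (p ^ suc a +_) eq) (regroup p (p ^ a) t)
  where
  regroup : ∀ p u t → p * u + (1 + p * t) ≡ 1 + p * (u + t)
  regroup = solve-∀

∤sum-powers : ∀ {p} → 1 < p → ∀ a → ¬ p ∣ sum (powers p a)
∤sum-powers {p} 1<p a p∣ with t , eq ← sum-powers≡1+p* p a =
  <⇒≢ 1<p (sym (∣1⇒≡1 (∣m+n∣m⇒∣n (subst (p ∣_) (trans eq (+-comm 1 (p * t))) p∣) (m∣m*n t))))

power<sum-powers : ∀ p {a} → 1 ≤ a → p ^ a < sum (powers p a)
power<sum-powers p {suc a} _ with t , eq ← sum-powers≡1+p* p a =
  m<m+n (p ^ suc a) (subst (0 <_) (sym eq) z<s)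

-- Multiplicativity: for coprime a, b the divisors of a * b are exactly the
-- products u * v of a divisor u ∣ a and a divisor v ∣ b, each arising once.

sum-scaled : ∀ u ys → sum (map (u *_) ys) ≡ u * sum ys
sum-scaled u []       = sym (*-zeroʳ u)
sum-scaled u (y ∷ ys) = trans (cong (u * y +_) (sum-scaled u ys)) (sym (*-distribˡ-+ u y (sum ys)))

sum-products : ∀ xs ys → sum (cartesianProductWith _*_ xs ys) ≡ sum xs * sum ys
sum-products []       ys = refl
sum-products (u ∷ us) ys = begin
  sum (map (u *_) ys ++ cartesianProductWith _*_ us ys)      ≡⟨ sum-++ (map (u *_) ys) _ ⟩
  sum (map (u *_) ys) + sum (cartesianProductWith _*_ us ys) ≡⟨ cong₂ _+_ (sum-scaled u ys) (sum-products us ys) ⟩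
  u * sum ys + sum us * sum ys                               ≡⟨ sym (*-distribʳ-+ (sum ys) u (sum us)) ⟩
  (u + sum us) * sum ys                                      ∎
  where open ≡-Reasoning

products-unique : ∀ {xs ys} → All NonZero xs → Unique xs → Unique ys →
  (∀ {u u' v v'} → u ∈ xs → u' ∈ xs → v ∈ ys → v' ∈ ys → u * v ≡ u' * v' → u ≡ u') →
  Unique (cartesianProductWith _*_ xs ys)
products-unique {[]}     _ _ _ _ = []
products-unique {u ∷ us} {ys} (All._∷_ u≢0 us≢0) (u∉us ∷ us!) ys! left =
  Unique.++⁺ (Unique.map⁺ (λ {v} {v'} → *-cancelˡ-≡ v v' u {{u≢0}}) ys!)
             (products-unique us≢0 us! ys! (λ u∈ u'∈ → left (there u∈) (there u'∈)))
             disjoint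
  where
  disjoint : ∀ {z} → ¬ (z ∈ map (u *_) ys × z ∈ cartesianProductWith _*_ us ys)
  disjoint (z∈ , z∈') with v , v∈ , refl ← ∈-map⁻ (u *_) z∈
                         | u' , v' , u'∈ , v'∈ , uv≡u'v' ← ∈-cartesianProductWith⁻ _*_ us ys z∈' =
    All.lookup u∉us u'∈ (left (here refl) (there u'∈) v∈ v'∈ uv≡u'v')

-- every divisor of a * b splits as (divisor of a) * (divisor of b):
-- take u = gcd z a and write z = u * w; then w ∣ b
∣product-split : ∀ {z a b} → .{{NonZero a}} → z ∣ a * b → ∃₂ λ u v → u ∣ a × v ∣ b × z ≡ u * v
∣product-split {z} {a} {b} z∣ab with gcd[m,n]∣m z a | gcd[m,n]∣n z a
... | divides w z≡wu | divides a' a≡a'u = u , w , gcd[m,n]∣n z a , w∣b , trans z≡wu (*-comm w u)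
  where
  u : ℕ
  u = gcd z a
  instance
    u≢0 : NonZero u
    u≢0 = ≢-nonZero (gcd[m,n]≢0 z a (inj₂ (≢-nonZero⁻¹ a)))
  w⊥a' : Coprime w a'
  w⊥a' {i} (i∣w , i∣a') = ∣1⇒≡1 (*-cancelʳ-∣ u (subst (i * u ∣_) (sym (*-identityˡ u))
    (gcd-greatest (subst (i * u ∣_) (sym z≡wu) (*-monoˡ-∣ u i∣w))
                  (subst (i * u ∣_) (sym a≡a'u) (*-monoˡ-∣ u i∣a')))))
  regroup : ∀ a' u b → a' * u * b ≡ a' * b * u
  regroup = solve-∀
  w∣a'b : w ∣ a' * b
  w∣a'b = *-cancelʳ-∣ u (subst₂ _∣_ z≡wu (trans (cong (_* b) a≡a'u) (regroup a' u b)) z∣ab)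
  w∣b : w ∣ b
  w∣b = coprime-divisor w⊥a' w∣a'b

-- with gcd(a, b) = 1 such a splitting is unique: u ∣ u' * v' and u ⊥ v' give u ∣ u'
coprime-split-unique : ∀ {a b u u' v v'} → Coprime a b → u ∣ a → u' ∣ a → v ∣ b → v' ∣ b →
  u * v ≡ u' * v' → u ≡ u'
coprime-split-unique {a} {b} {u} {u'} {v} {v'} a⊥b u∣a u'∣a v∣b v'∣b uv≡u'v' =
  ∣-antisym (coprime-divisor (divisors-coprime u∣a v'∣b)
                             (subst (u ∣_) (trans uv≡u'v' (*-comm u' v')) (m∣m*n v)))
            (coprime-divisor (divisors-coprime u'∣a v∣b)
                             (subst (u' ∣_) (trans (sym uv≡u'v') (*-comm u v)) (m∣m*n v')))
  where
  divisors-coprime : ∀ {s t} → s ∣ a → t ∣ b → Coprime s t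
  divisors-coprime s∣a t∣b (i∣s , i∣t) = a⊥b (∣-trans i∣s s∣a , ∣-trans i∣t t∣b)

σ-multiplicative : ∀ {a b} → Coprime a b → .{{NonZero a}} → .{{NonZero b}} → σ (a * b) ≡ σ a * σ b
σ-multiplicative {a} {b} a⊥b = trans
  (σ-enumeration (products-unique (All.tabulate divisor≢0) (divisors-unique a) (divisors-unique b)
                   λ u∈ u'∈ v∈ v'∈ → coprime-split-unique a⊥b (∈-divisors⁻ u∈) (∈-divisors⁻ u'∈)
                                                          (∈-divisors⁻ v∈) (∈-divisors⁻ v'∈))
                 sound complete)
  (sum-products (divisors a) (divisors b))
  where
  instance
    ab≢0 : NonZero (a * b)
    ab≢0 = m*n≢0 a b
  divisor≢0 : ∀ {u} → u ∈ divisors a → NonZero u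
  divisor≢0 u∈ = ≢-nonZero λ { refl → ≢-nonZero⁻¹ a (0∣⇒≡0 (∈-divisors⁻ u∈)) }
  sound : ∀ {z} → z ∈ cartesianProductWith _*_ (divisors a) (divisors b) → z ∣ a * b
  sound z∈ with u , v , u∈ , v∈ , refl ← ∈-cartesianProductWith⁻ _*_ (divisors a) (divisors b) z∈ =
    *-pres-∣ (∈-divisors⁻ {a} u∈) (∈-divisors⁻ {b} v∈)
  complete : ∀ {z} → z ∣ a * b → z ∈ cartesianProductWith _*_ (divisors a) (divisors b)
  complete z∣ab with u , v , u∣a , v∣b , refl ← ∣product-split {b = b} z∣ab =
    ∈-cartesianProductWith⁺ _*_ (∈-divisors⁺ u∣a) (∈-divisors⁺ v∣b)

odd⇒1+2* : ∀ n → ¬ 2 ∣ n → ∃ λ s → n ≡ 1 + 2 * s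
odd⇒1+2* zero          2∤0 = ⊥-elim (2∤0 (divides 0 refl))
odd⇒1+2* (suc zero)    _   = 0 , refl
odd⇒1+2* (suc (suc n)) 2∤n+2 with s , refl ← odd⇒1+2* n (λ 2∣n → 2∤n+2 (∣m∣n⇒∣m+n (∣-refl {2}) 2∣n)) =
  suc s , regroup s
  where
  regroup : ∀ s → 2 + (1 + 2 * s) ≡ 1 + 2 * (1 + s)
  regroup = solve-∀

odd-divisor : ∀ {n d} → ¬ 2 ∣ n → d ∣ n → ¬ 2 ∣ d
odd-divisor 2∤n d∣n 2∣d = 2∤n (∣-trans 2∣d d∣n)

odd-gap : ∀ {q r} → ¬ 2 ∣ q → ¬ 2 ∣ r → q < r → ∃ λ t → r ≡ q + (2 + 2 * t)
odd-gap {q} {r} 2∤q 2∤r q<r with s , refl ← odd⇒1+2* q 2∤q | s' , refl ← odd⇒1+2* r 2∤r =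
  s' ∸ suc s , trans (cong (λ n → 1 + 2 * n) (sym (m+[n∸m]≡n s<s'))) (regroup s (s' ∸ suc s))
  where
  s<s' : s < s'
  s<s' = *-cancelˡ-< 2 s s' (≤-pred q<r)
  regroup : ∀ s t → 1 + 2 * (suc s + t) ≡ 1 + 2 * s + (2 + 2 * t)
  regroup = solve-∀

odd⇒2∣σ[p] : ∀ {p} → ¬ 2 ∣ p → 2 ∣ sum (powers p 1)
odd⇒2∣σ[p] {p} 2∤p with s , refl ← odd⇒1+2* p 2∤p = divides (1 + s) (σ≡ s)
  where
  σ≡ : ∀ s → (1 + 2 * s) * 1 + (1 + 0) ≡ (1 + s) * 2
  σ≡ = solve-∀

≤-by : ∀ {a b} c → b ≡ a + c → a ≤ b
≤-by {a} c refl = m≤m+n a c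

-- a divisor x of an odd w with w < 3x is w itself (the cofactor is odd and < 3)
odd-divisor-above-third : ∀ {x w k} → x ∣ w → w ≡ 1 + 2 * k → w < 3 * x → w ≡ x
odd-divisor-above-third (divides zero w≡0) w-odd _ with () ← trans (sym w≡0) w-odd
odd-divisor-above-third {x} (divides 1 w≡x) _ _ = trans w≡x (*-identityˡ x)
odd-divisor-above-third {x} {k = k} (divides 2 w≡2x) w-odd _ =
  ⊥-elim (even≢odd x k (trans (sym w≡2x) w-odd))
odd-divisor-above-third {x} (divides (suc (suc (suc j))) refl) _ w<3x =
  ⊥-elim (<⇒≱ w<3x (*-monoˡ-≤ x {3} {3 + j} (s≤s (s≤s (s≤s z≤n)))))

square-not-prime : ∀ s → ¬ Prime (s * s)
square-not-prime zero          p0 with () ← prime⇒nonZero p0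
square-not-prime (suc zero)    p1 with () ← prime⇒nonTrivial p1
square-not-prime s@(suc (suc _)) ps =
  composite⇒¬prime (composite-≢ s s≢s² (divides s refl)) ps
  where
  s≢s² : s ≢ s * s
  s≢s² eq with () ← *-cancelˡ-≡ 1 s s (trans (*-identityʳ s) eq)

-- Then r ∤ σ(qᵃ) and q ∤ σ(rᵃ) for a ≤ 2.  For a = 1 this is a size argument; for
-- a = 2 the relevant σ is, modulo the other prime, a small odd number, which can
-- only vanish if q or r is a perfect square.
module ClosePrimes (q t : ℕ) (pq : Prime q) (pr : Prime (q + (2 + 2 * t)))
                   (close : (4 + 2 * t) * (4 + 2 * t) < 3 * q) where

  r : ℕ
  r = q + (2 + 2 * t)

  instance
    q≢0 : NonZero q
    q≢0 = prime⇒nonZero pq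
    r≢0 : NonZero r
    r≢0 = prime⇒nonZero pr

  q<r : q < r
  q<r = m<m+n q z<s

  -- σ(r) = r + 1 = q + (3 + 2t), and q ∣ 3 + 2t would force 3q ≤ (4 + 2t)²
  q∤σ[r] : ¬ q ∣ sum (powers r 1)
  q∤σ[r] q∣ = <-irrefl refl (begin-strict
    3 * q                     ≤⟨ *-monoʳ-≤ 3 (∣⇒≤ q∣3+2t) ⟩
    3 * (3 + 2 * t)           ≤⟨ ≤-by (7 + 10 * t + 4 * t * t) (expand t) ⟩
    (4 + 2 * t) * (4 + 2 * t) <⟨ close ⟩
    3 * q                     ∎)
    where
    open ≤-Reasoning
    σ[r]≡ : ∀ q t → (q + (2 + 2 * t)) * 1 + (1 + 0) ≡ q + (3 + 2 * t)
    σ[r]≡ = solve-∀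
    expand : ∀ t → (4 + 2 * t) * (4 + 2 * t) ≡ 3 * (3 + 2 * t) + (7 + 10 * t + 4 * t * t)
    expand = solve-∀
    q∣3+2t : q ∣ 3 + 2 * t
    q∣3+2t = ∣m+n∣m⇒∣n (subst (q ∣_) (σ[r]≡ q t) q∣) ∣-refl

  -- σ(q) = q + 1 < r
  r∤σ[q] : ¬ r ∣ sum (powers q 1)
  r∤σ[q] r∣ = <⇒≱ 1+q<r (∣⇒≤ (subst (r ∣_) σ[q]≡1+q r∣))
    where
    σ[q]≡1+q : sum (powers q 1) ≡ suc q
    σ[q]≡1+q = trans (cong (_+ 1) (*-identityʳ q)) (+-comm q 1)
    1+q<r : suc q < r
    1+q<r = subst (_< r) (+-comm q 1) (+-monoʳ-< q {1} {2 + 2 * t} (s≤s (s≤s z≤n)))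

  -- σ(q²) + r (1 + 2t) = q r + w with w = 3 + 6t + 4t², odd and < 3r;
  -- so r ∣ σ(q²) gives w = r, i.e. q = (1 + 2t)²
  r∤σ[q²] : ¬ r ∣ sum (powers q 2)
  r∤σ[q²] r∣ = square-not-prime (1 + 2 * t) (subst Prime q≡square pq)
    where
    w : ℕ
    w = 3 + 6 * t + 4 * t * t
    σ[q²]≡ : ∀ q t → q * (q * 1) + (q * 1 + (1 + 0)) + (q + (2 + 2 * t)) * (1 + 2 * t)
                    ≡ q * (q + (2 + 2 * t)) + (3 + 6 * t + 4 * t * t)
    σ[q²]≡ = solve-∀
    r∣w : r ∣ w
    r∣w = ∣m+n∣m⇒∣n (subst (r ∣_) (σ[q²]≡ q t) (∣m∣n⇒∣m+n r∣ (m∣m*n (1 + 2 * t)))) (n∣m*n q)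
    w-bound : ∀ t → (4 + 2 * t) * (4 + 2 * t) ≡ 3 + 6 * t + 4 * t * t + (13 + 10 * t)
    w-bound = solve-∀
    w-odd : ∀ t → 3 + 6 * t + 4 * t * t ≡ 1 + 2 * (1 + 3 * t + 2 * t * t)
    w-odd = solve-∀
    w≡r : w ≡ r
    w≡r = odd-divisor-above-third {k = 1 + 3 * t + 2 * t * t} r∣w (w-odd t)
            (<-≤-trans (≤-<-trans (≤-by _ (w-bound t)) close) (*-monoʳ-≤ 3 (<⇒≤ q<r)))
    w≡ : ∀ t → 3 + 6 * t + 4 * t * t ≡ (1 + 2 * t) * (1 + 2 * t) + (2 + 2 * t)
    w≡ = solve-∀
    q≡square : q ≡ (1 + 2 * t) * (1 + 2 * t)
    q≡square = +-cancelʳ-≡ (2 + 2 * t) q _ (trans (sym w≡r) (w≡ t))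

  -- σ(r²) = q (q + 2d + 1) + w with w = 7 + 10t + 4t², odd and < 3q;
  -- so q ∣ σ(r²) gives w = q, i.e. r = (3 + 2t)²
  q∤σ[r²] : ¬ q ∣ sum (powers r 2)
  q∤σ[r²] q∣ = square-not-prime (3 + 2 * t) (subst Prime r≡square pr)
    where
    w : ℕ
    w = 7 + 10 * t + 4 * t * t
    σ[r²]≡ : ∀ q t → (q + (2 + 2 * t)) * ((q + (2 + 2 * t)) * 1) + ((q + (2 + 2 * t)) * 1 + (1 + 0))
                    ≡ q * (q + 2 * (2 + 2 * t) + 1) + (7 + 10 * t + 4 * t * t)
    σ[r²]≡ = solve-∀
    q∣w : q ∣ w
    q∣w = ∣m+n∣m⇒∣n (subst (q ∣_) (σ[r²]≡ q t) q∣) (m∣m*n _)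
    w-bound : ∀ t → (4 + 2 * t) * (4 + 2 * t) ≡ 7 + 10 * t + 4 * t * t + (9 + 6 * t)
    w-bound = solve-∀
    w-odd : ∀ t → 7 + 10 * t + 4 * t * t ≡ 1 + 2 * (3 + 5 * t + 2 * t * t)
    w-odd = solve-∀
    w≡q : w ≡ q
    w≡q = odd-divisor-above-third {k = 3 + 5 * t + 2 * t * t} q∣w (w-odd t) (≤-<-trans (≤-by _ (w-bound t)) close)
    w≡ : ∀ t → 7 + 10 * t + 4 * t * t + (2 + 2 * t) ≡ (3 + 2 * t) * (3 + 2 * t)
    w≡ = solve-∀
    r≡square : r ≡ (3 + 2 * t) * (3 + 2 * t)
    r≡square = trans (cong (_+ (2 + 2 * t)) (sym w≡q)) (w≡ t)

  r∤σ[qᵃ] : ∀ a → a ≤ 2 → ¬ r ∣ sum (powers q a)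
  r∤σ[qᵃ] zero          _ = prime∤1 pr
  r∤σ[qᵃ] 1             _ = r∤σ[q]
  r∤σ[qᵃ] 2             _ = r∤σ[q²]
  r∤σ[qᵃ] (suc (suc (suc _))) (s≤s (s≤s ()))

  q∤σ[rᵃ] : ∀ a → a ≤ 2 → ¬ q ∣ sum (powers r a)
  q∤σ[rᵃ] zero          _ = prime∤1 pq
  q∤σ[rᵃ] 1             _ = q∤σ[r]
  q∤σ[rᵃ] 2             _ = q∤σ[r²]
  q∤σ[rᵃ] (suc (suc (suc _))) (s≤s (s≤s ()))

power-comparison : ∀ {q r} → .{{NonZero q}} → q ≤ r → ∀ i j → 6 ≤ i + j → q ^ 6 ≤ q ^ i * r ^ j
power-comparison {q} {r} q≤r i j 6≤i+j = begin
  q ^ 6         ≤⟨ ^-monoʳ-≤ q 6≤i+j ⟩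
  q ^ (i + j)   ≡⟨ ^-distribˡ-+-* q i j ⟩
  q ^ i * q ^ j ≤⟨ *-monoʳ-≤ (q ^ i) (^-monoˡ-≤ j q≤r) ⟩
  q ^ i * r ^ j ∎
  where open ≤-Reasoning

small-exponents : ∀ {x y} → 1 ≤ x → x ≤ 2 → 1 ≤ y → y ≤ 2 → ¬ (x ≡ 1 × y ≡ 1) → 6 ≤ x + x + (y + y)
small-exponents {1} {1} _ _ _ _ not-both = ⊥-elim (not-both (refl , refl))
small-exponents {1} {2} _ _ _ _ _ = ≤-refl
small-exponents {2} {1} _ _ _ _ _ = ≤-refl
small-exponents {2} {2} _ _ _ _ _ = m≤m+n 6 2
small-exponents {suc (suc (suc _))} _ (s≤s (s≤s ())) _ _ _
small-exponents {x} {suc (suc (suc _))} _ _ _ (s≤s (s≤s ())) _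

module CloseTopPrimes (M q t x y : ℕ) (pq : Prime q) (pr : Prime (q + (2 + 2 * t)))
  (close : (4 + 2 * t) * (4 + 2 * t) < 3 * q)
  (q∤M : ¬ q ∣ M) (r∤M : ¬ q + (2 + 2 * t) ∣ M) (1≤x : 1 ≤ x) (1≤y : 1 ≤ y)
  (N-odd : ¬ 2 ∣ M * q ^ x * (q + (2 + 2 * t)) ^ y)
  (perfect : Perfect (M * q ^ x * (q + (2 + 2 * t)) ^ y)) where

  open ClosePrimes q t pq pr close

  N S Q R : ℕ
  N = M * q ^ x * r ^ y
  S = σ M
  Q = sum (powers q x)
  R = sum (powers r y)

  N≢0 : N ≢ 0
  N≢0 N≡0 = N-odd (subst (2 ∣_) (sym N≡0) (divides 0 refl))

  instance
    M≢0 : NonZero M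
    M≢0 = ≢-nonZero λ { refl → N≢0 refl }
    q^x≢0 : NonZero (q ^ x)
    q^x≢0 = m^n≢0 q x
    r^y≢0 : NonZero (r ^ y)
    r^y≢0 = m^n≢0 r y
    Mq^x≢0 : NonZero (M * q ^ x)
    Mq^x≢0 = m*n≢0 M (q ^ x)

  -- r ∤ qˣ since r > q
  r∤Mq^x : ¬ r ∣ M * q ^ x
  r∤Mq^x = prime∤product pr r∤M λ r∣q^x → <⇒≱ q<r (∣⇒≤ (prime∣power⇒prime∣ pr x r∣q^x))

  σ-factorisation : S * Q * R ≡ 2 * N
  σ-factorisation = begin
    S * Q * R                   ≡⟨ cong₂ (λ A B → S * A * B) (sym (σ-prime-power pq x)) (sym (σ-prime-power pr y)) ⟩
    σ M * σ (q ^ x) * σ (r ^ y) ≡⟨ cong (_* σ (r ^ y)) (sym (σ-multiplicative M⊥q^x)) ⟩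
    σ (M * q ^ x) * σ (r ^ y)   ≡⟨ sym (σ-multiplicative Mq^x⊥r^y) ⟩
    σ N                         ≡⟨ perfect ⟩
    2 * N                       ∎
    where
    open ≡-Reasoning
    M⊥q^x : Coprime M (q ^ x)
    M⊥q^x = Coprimality.sym (prime∤⇒coprime-power pq q∤M x)
    Mq^x⊥r^y : Coprime (M * q ^ x) (r ^ y)
    Mq^x⊥r^y = Coprimality.sym (prime∤⇒coprime-power pr r∤Mq^x y)

  ∣N⇒∣QRS : ∀ {d} → d ∣ N → d ∣ Q * R * S
  ∣N⇒∣QRS {d} d∣N = subst (d ∣_) (trans (sym σ-factorisation) (rotate S Q R)) (∣n⇒∣m*n 2 d∣N)
    where
    rotate : ∀ S Q R → S * Q * R ≡ Q * R * S
    rotate = solve-∀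

  q^x∣N : q ^ x ∣ N
  q^x∣N = ∣m⇒∣m*n (r ^ y) (n∣m*n M)

  r^y∣N : r ^ y ∣ N
  r^y∣N = n∣m*n (M * q ^ x)

  q∣N : q ∣ N
  q∣N = ∣-trans (base-∣-power x 1≤x) q^x∣N

  r∣N : r ∣ N
  r∣N = ∣-trans (base-∣-power y 1≤y) r^y∣N

  q^x∣S : y ≤ 2 → q ^ x ∣ S
  q^x∣S y≤2 = prime-power-∣-cancel pq q∤QR x (∣N⇒∣QRS q^x∣N)
    where
    q∤QR : ¬ q ∣ Q * R
    q∤QR = prime∤product pq (∤sum-powers (prime>1 pq) x) (q∤σ[rᵃ] y y≤2)

  r^y∣S : x ≤ 2 → r ^ y ∣ S
  r^y∣S x≤2 = prime-power-∣-cancel pr r∤QR y (∣N⇒∣QRS r^y∣N)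
    where
    r∤QR : ¬ r ∣ Q * R
    r∤QR = prime∤product pr (r∤σ[qᵃ] x x≤2) (∤sum-powers (prime>1 pr) y)

  -- x = y = 1 would give 4 ∣ (q + 1)(r + 1) ∣ 2N, making N even
  not-both-one : ¬ (x ≡ 1 × y ≡ 1)
  not-both-one (refl , refl) = N-odd (*-cancelˡ-∣ 2 4∣2N)
    where
    4∣2N : 2 * 2 ∣ 2 * N
    4∣2N = subst (2 * 2 ∣_) (trans (sym (*-assoc S Q R)) σ-factorisation)
             (∣n⇒∣m*n S (*-pres-∣ (odd⇒2∣σ[p] (odd-divisor N-odd q∣N))
                                  (odd⇒2∣σ[p] (odd-divisor N-odd r∣N))))

  sixth-power-bound : ∀ u v → q ^ u * r ^ v ∣ S → 6 ≤ u + x + (v + y) → q ^ 6 < 2 * N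
  sixth-power-bound u v qᵘrᵛ∣S 6≤ = begin-strict
    q ^ 6                           ≤⟨ power-comparison (<⇒≤ q<r) (u + x) (v + y) 6≤ ⟩
    q ^ (u + x) * r ^ (v + y)       ≡⟨ cong₂ _*_ (^-distribˡ-+-* q u x) (^-distribˡ-+-* r v y) ⟩
    q ^ u * q ^ x * (r ^ v * r ^ y) ≡⟨ interchange (q ^ u) (q ^ x) (r ^ v) (r ^ y) ⟩
    q ^ u * r ^ v * (q ^ x * r ^ y) ≤⟨ *-monoˡ-≤ (q ^ x * r ^ y) (∣⇒≤ {{S≢0}} qᵘrᵛ∣S) ⟩
    S * (q ^ x * r ^ y)             <⟨ *-monoʳ-< S {{S≢0}} (*-mono-< q^x<Q r^y<R) ⟩
    S * (Q * R)                     ≡⟨ sym (*-assoc S Q R) ⟩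
    S * Q * R                       ≡⟨ σ-factorisation ⟩
    2 * N                           ∎
    where
    open ≤-Reasoning
    q^x<Q : q ^ x < Q
    q^x<Q = power<sum-powers q 1≤x
    r^y<R : r ^ y < R
    r^y<R = power<sum-powers r 1≤y
    interchange : ∀ a b c d → a * b * (c * d) ≡ a * c * (b * d)
    interchange = solve-∀
    S≢0 : NonZero S
    S≢0 = ≢-nonZero λ S≡0 →
      N≢0 (*-cancelˡ-≡ N 0 2 (trans (sym σ-factorisation) (cong (λ s → s * Q * R) S≡0)))

  sixth-power<2N : q ^ 6 < 2 * N
  sixth-power<2N with x ≤? 2 | y ≤? 2
  ... | yes x≤2 | yes y≤2 =
    sixth-power-bound x y (coprime-∣-product (prime∤⇒coprime-power pq q∤r^y x) (q^x∣S y≤2) (r^y∣S x≤2))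
                      (small-exponents 1≤x x≤2 1≤y y≤2 not-both-one)
    where
    q∤r^y : ¬ q ∣ r ^ y
    q∤r^y q∣r^y with prime⇒irreducible pr (prime∣power⇒prime∣ pq y q∣r^y)
    ... | inj₁ q≡1 = <⇒≢ (prime>1 pq) (sym q≡1)
    ... | inj₂ q≡r = <⇒≢ q<r q≡r
  ... | yes x≤2 | no  y≰2 =
    sixth-power-bound 0 y (subst (_∣ S) (sym (*-identityˡ (r ^ y))) (r^y∣S x≤2))
                      (≤-trans (n≤1+n 6) (+-mono-≤ 1≤x (+-mono-≤ (≰⇒> y≰2) (≰⇒> y≰2))))
  ... | no  x≰2 | yes y≤2 =
    sixth-power-bound x 0 (subst (_∣ S) (sym (*-identityʳ (q ^ x))) (q^x∣S y≤2))
                      (≤-trans (n≤1+n 6) (+-mono-≤ (+-mono-≤ (≰⇒> x≰2) (≰⇒> x≰2)) 1≤y))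
  ... | no  x≰2 | no  y≰2 =
    sixth-power-bound 0 0 (1∣ S) (+-mono-≤ (≰⇒> x≰2) (≰⇒> y≰2))

gap-square : ∀ q t → (q + (2 + 2 * t) + 2 ∸ q) ^ 2 ≡ (4 + 2 * t) * (4 + 2 * t)
gap-square q t = begin
  (q + (2 + 2 * t) + 2 ∸ q) ^ 2 ≡⟨ cong (λ n → (n ∸ q) ^ 2) (regroup q t) ⟩
  (q + (4 + 2 * t) ∸ q) ^ 2     ≡⟨ cong (_^ 2) (m+n∸m≡n q (4 + 2 * t)) ⟩
  (4 + 2 * t) ^ 2               ≡⟨ cong ((4 + 2 * t) *_) (*-identityʳ (4 + 2 * t)) ⟩
  (4 + 2 * t) * (4 + 2 * t)     ∎
  where
  open ≡-Reasoning
  regroup : ∀ q t → q + (2 + 2 * t) + 2 ≡ q + (4 + 2 * t)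
  regroup = solve-∀

-- The theorem for an odd perfect N = M qˣ rʸ whose two distinguished primes
-- q < r do not divide M: both are odd, so r = q + (2 + 2t) and CloseTopPrimes applies.
top-two-primes-bound : ∀ {N M q r x y} → N ≡ M * q ^ x * r ^ y → Prime q → Prime r → q < r →
  ¬ q ∣ M → ¬ r ∣ M → 1 ≤ x → 1 ≤ y → ¬ 2 ∣ N → Perfect N → (r + 2 ∸ q) ^ 2 < 3 * q →
  q ^ 6 < 2 * N
top-two-primes-bound {M = M} {q} {r} {x} {y} refl pq pr q<r q∤M r∤M 1≤x 1≤y N-odd perfect close =
  with-gap (odd-gap (odd-divisor N-odd (∣m⇒∣m*n (r ^ y) (∣n⇒∣m*n M (base-∣-power x 1≤x))))
                    (odd-divisor N-odd (∣n⇒∣m*n (M * q ^ x) (base-∣-power y 1≤y))) q<r)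
  where
  with-gap : (∃ λ t → r ≡ q + (2 + 2 * t)) → q ^ 6 < 2 * (M * q ^ x * r ^ y)
  with-gap (t , refl) = CloseTopPrimes.sixth-power<2N M q t x y pq pr
    (subst (_< 3 * q) (gap-square q t) close) q∤M r∤M 1≤x 1≤y N-odd perfect

∏-last : ∀ k (f : Fin (suc k) → ℕ) → ∏ (suc k) f ≡ ∏ k (λ i → f (inject₁ i)) * f (fromℕ k)
∏-last zero    f = *-comm (f F.zero) 1
∏-last (suc k) f = trans (cong (f F.zero *_) (∏-last k (λ i → f (F.suc i)))) (sym (*-assoc (f F.zero) _ _))

∏-last-two : ∀ m (f : Fin (suc (suc m)) → ℕ) →
  ∏ (suc (suc m)) f ≡ ∏ m (λ i → f (inject₁ (inject₁ i))) * f (inject₁ (fromℕ m)) * f (fromℕ (suc m))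
∏-last-two m f = trans (∏-last (suc m) f) (cong (_* f (fromℕ (suc m))) (∏-last m (λ i → f (inject₁ i))))

prime∣∏ : ∀ {P} → Prime P → ∀ k (f : Fin k → ℕ) → P ∣ ∏ k f → ∃ λ i → P ∣ f i
prime∣∏ pP zero    f P∣1 with () ← prime∤1 pP P∣1
prime∣∏ pP (suc k) f P∣ with euclidsLemma (f F.zero) (∏ k (λ i → f (F.suc i))) pP P∣
... | inj₁ P∣f₀ = F.zero , P∣f₀
... | inj₂ P∣∏ with i , P∣fᵢ ← prime∣∏ pP k (λ i → f (F.suc i)) P∣∏ = F.suc i , P∣fᵢ

larger-prime∤∏ : ∀ {P k} (p a : Fin k → ℕ) → Prime P → (∀ i → Prime (p i)) → (∀ i → p i < P) →
  ¬ P ∣ ∏ k (λ i → p i ^ a i)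
larger-prime∤∏ {P} {k} p a pP primes below P∣ with i , P∣pᵢ^aᵢ ← prime∣∏ pP k (λ i → p i ^ a i) P∣ =
  <⇒≱ (below i) (∣⇒≤ {{prime⇒nonZero (primes i)}} (prime∣power⇒prime∣ pP (a i) P∣pᵢ^aᵢ))

inject₁<fromℕ : ∀ {n} (i : Fin n) → inject₁ i F.< fromℕ n
inject₁<fromℕ {n} i = subst (toℕ (inject₁ i) <_) (sym (toℕ-fromℕ n)) (inject₁ℕ< i)

inject₁-mono-< : ∀ {n} {i j : Fin n} → i F.< j → inject₁ i F.< inject₁ j
inject₁-mono-< {i = i} {j} = subst₂ _<_ (sym (toℕ-inject₁ i)) (sym (toℕ-inject₁ j))

mainTheorem5 : (N : ℕ) → N % 2 ≡ 1 → Perfect N →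
    (m : ℕ) (p a : Fin (suc (suc m)) → ℕ) →
    (∀ i → Prime (p i)) →
    (∀ (i j : Fin (suc (suc m))) → i F.< j → p i < p j) →
    (∀ i → 1 ≤ a i) →
    N ≡ ∏ (suc (suc m)) (λ i → p i ^ a i) →
    (p (fromℕ (suc m)) + 2 ∸ p (inject₁ (fromℕ m))) ^ 2 < 3 * p (inject₁ (fromℕ m)) →
    p (inject₁ (fromℕ m)) ^ 6 < 2 * N
mainTheorem5 N N%2≡1 perfect m p a primes increasing 1≤a N≡∏ close =
  top-two-primes-bound (trans N≡∏ (∏-last-two m (λ i → p i ^ a i)))
    (primes penult) (primes last) (increasing penult last penult<last)
    (∤rest penult lower<penult) (∤rest last lower<last)
    (1≤a penult) (1≤a last) N-odd perfect close
  where
  penult last : Fin (suc (suc m))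
  penult = inject₁ (fromℕ m)
  last   = fromℕ (suc m)
  lower : Fin m → Fin (suc (suc m))
  lower i = inject₁ (inject₁ i)
  penult<last : penult F.< last
  penult<last = inject₁<fromℕ (fromℕ m)
  lower<penult : ∀ i → lower i F.< penult
  lower<penult i = inject₁-mono-< (inject₁<fromℕ i)
  lower<last : ∀ i → lower i F.< last
  lower<last i = inject₁<fromℕ (inject₁ i)
  ∤rest : ∀ j → (∀ i → lower i F.< j) → ¬ p j ∣ ∏ m (λ i → p (lower i) ^ a (lower i))
  ∤rest j below = larger-prime∤∏ (p ∘ lower) (a ∘ lower) (primes j) (primes ∘ lower) (λ i → increasing _ _ (below i))
  N-odd : ¬ 2 ∣ N
  N-odd 2∣N with () ← trans (sym (n∣m⇒m%n≡0 N 2 2∣N)) N%2≡1
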